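{- Let $PS=D\cup LP\cup MP\cup IC$ be a P2P system such that no negative literal occurs in any standard rule of $LP$. Then the max-min preference relation $\sqsupseteq$ is a partial order on the set $WM(PS)$ of weak models of $PS$.
   Context: Fix finite sets of predicate symbols, constants and variables. A peer identifier is a positive integer; a (peer) atom is $i{:}p(t_1,\dots,t_k)$; a literal is $A$ or $\mathit{not}\ A$ (negation as failure); built-in atoms are $X\,\theta\,Y$, $\theta\in\{<,>,\le,\ge,=,\ne\}$. Rules: standard rules $H\leftarrow\mathcal B$ with $H=i{:}h(X)$, $\mathcal B=j{:}p_1(X_1),\dots,j{:}p_m(X_m),\mathit{not}\ j{:}p_{m+1}(X_{m+1}),\dots,\mathit{not}\ j{:}p_n(X_n),\varphi$ ($\varphi$ built-ins); integrity constraints $\leftarrow\mathcal B$ with $\mathcal B$ of that form over one identifier; maximal mapping rules $H\leftharpoonup\mathcal B$ and minimal mapping rules $H\leftharpoondown\mathcal B$ with $H=i{:}h(X)$, $\mathcal B=j{:}p_1(X_1),\dots,j{:}p_m(X_m),\varphi$, $i\ne j$. Rules are safe. A peer is $P_i=\langle D_i,LP_i,MP_i,IC_i\rangle$ (ground facts with identifier $i$; standard rules with head/body identifier $i$; mapping rules with head identifier $i$; constraints with identifier $i$). A P2P system is $PS=\{P_1,\dots,P_n\}$ with identifiers of mapping rule bodies in $\{1,\dots,n\}$; $D,LP,MP,IC$ are unions, $\overline{MP}$ and $\underline{MP}$ the sets of maximal and minimal mapping rules in $MP$; $PS$ identified with $D\cup LP\cup MP\cup IC$. Each mapping predicate (predicate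 in the head of a mapping rule) is the head predicate of exactly one mapping rule. For an interpretation $M$, $M[MP]$, $M[\overline{MP}]$, $M[\underline{MP}]$ are the atoms of $M$ whose predicate is the head predicate of a mapping rule, a maximal mapping rule, a minimal mapping rule, respectively. $St(r)=H\leftarrow\mathcal B$ for a mapping rule $r$; $St(Q)$ replaces each mapping rule by $St(r)$. Truth in $M$: conjunction true iff positive atoms in $M$, negated atoms not, built-ins hold; ground standard rule true iff body false or head in $M$; ground constraint true iff body false. $MM(Q)$ = inclusion-minimal models. Weak model: $\{M\}=MM(St(PS^M))$, with $PS^M$ obtained from $ground(PS)$ by removing every standard rule or constraint with a body literal $\mathit{not}\ A$, $A\in M$, deleting negative literals from the rest, and removing ground mapping rules whose head is not in $M$. For weak models $M,N$: $M\sqsupseteq N$ iff either $M[\overline{MP}]\supsetneq N[\overline{MP}]$, or $M[\overline{MP}]=N[\overline{MP}]$ and $M[\underline{MP}]\subseteq N[\underline{MP}]$. -}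

module Defs where

open import Data.Nat using (ℕ; zero; suc; _<_; _≤_; _>_; _≥_)
open import Data.List using (List; []; _∷_; length; lookup; concatMap; map; _++_)
open import Data.List.Membership.Propositional using (_∈_)
open import Data.List.Relation.Unary.All using (All)
open import Data.Fin using (Fin; toℕ)
open import Data.Product using (Σ; _×_; _,_; proj₁)
open import Data.Sum using (_⊎_)
open import Data.Empty using (⊥)
open import Relation.Nullary using (¬_)
open import Relation.Binary.PropositionalEquality using (_≡_; _≢_)
open import Relation.Binary.Structures using (IsPartialOrder)

-- Peer identifiers, predicate symbols, constants and variables
-- are natural numbers; the finitely many symbols actually used are those
-- occurring in the (finite) system.  The fixed finite set of constants
-- (the grounding universe) is the field `consts` of a system.

PeerId PredSym Const Var : Set
PeerId  = ℕ
PredSym = ℕ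
Const   = ℕ
Var     = ℕ

data Term : Set where
  con : Const → Term
  var : Var → Term

record Atom : Set where
  constructor atom
  field
    peer : PeerId
    pred : PredSym
    args : List Term

record GAtom : Set where
  constructor gatom
  field
    peer : PeerId
    pred : PredSym
    args : List Const

data Cmp : Set where
  lt gt le ge eq ne : Cmp

record BuiltIn : Set where
  constructor builtin
  field
    cmp : Cmp
    lhs : Term
    rhs : Term

data Literal : Set where
  pos : Atom → Literal
  neg : Atom → Literal

litAtom : Literal → Atom
litAtom (pos a) = a
litAtom (neg a) = a

posAtoms : List Literal → List Atom
posAtoms [] = []
posAtoms (pos a ∷ ls) = a ∷ posAtoms ls
posAtoms (neg a ∷ ls) = posAtoms ls

negAtoms : List Literal → List Atom
negAtoms [] = []
negAtoms (pos a ∷ ls) = negAtoms ls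
negAtoms (neg a ∷ ls) = a ∷ negAtoms ls

record StdRule : Set where
  constructor stdRule
  field
    head     : Atom
    body     : List Literal
    builtins : List BuiltIn

record Constraint : Set where
  constructor constraint
  field
    body     : List Literal
    builtins : List BuiltIn

data MapKind : Set where
  maximal minimal : MapKind

record MapRule : Set where
  constructor mapRule
  field
    kind     : MapKind
    head     : Atom
    body     : List Atom
    builtins : List BuiltIn

record Peer : Set where
  constructor peerDef
  field
    D  : List GAtom
    LP : List StdRule
    MP : List MapRule
    IC : List Constraint

-- A P2P system {P_1,…,P_n}: the k-th element of `peers` (0-based) is the
-- peer with identifier k+1.  `consts` is the fixed finite set of constants.
record P2PSystem : Set where
  constructor p2p
  field
    consts : List Const
    peers  : List Peer

module _ (PS : P2PSystem) where
  open P2PSystem PS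
  Dᵘ : List GAtom
  Dᵘ = concatMap Peer.D peers
  LPᵘ : List StdRule
  LPᵘ = concatMap Peer.LP peers
  MPᵘ : List MapRule
  MPᵘ = concatMap Peer.MP peers
  ICᵘ : List Constraint
  ICᵘ = concatMap Peer.IC peers

varsT : Term → List Var
varsT (con _) = []
varsT (var v) = v ∷ []

constsT : Term → List Const
constsT (con c) = c ∷ []
constsT (var _) = []

varsA : Atom → List Var
varsA a = concatMap varsT (Atom.args a)

constsA : Atom → List Const
constsA a = concatMap constsT (Atom.args a)

varsB : BuiltIn → List Var
varsB b = varsT (BuiltIn.lhs b) ++ varsT (BuiltIn.rhs b)

constsB : BuiltIn → List Const
constsB b = constsT (BuiltIn.lhs b) ++ constsT (BuiltIn.rhs b)

varsStd : StdRule → List Var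
varsStd r = varsA (StdRule.head r)
         ++ concatMap (λ l → varsA (litAtom l)) (StdRule.body r)
         ++ concatMap varsB (StdRule.builtins r)

constsStd : StdRule → List Const
constsStd r = constsA (StdRule.head r)
           ++ concatMap (λ l → constsA (litAtom l)) (StdRule.body r)
           ++ concatMap constsB (StdRule.builtins r)

varsIC : Constraint → List Var
varsIC c = concatMap (λ l → varsA (litAtom l)) (Constraint.body c)
        ++ concatMap varsB (Constraint.builtins c)

constsIC : Constraint → List Const
constsIC c = concatMap (λ l → constsA (litAtom l)) (Constraint.body c)
          ++ concatMap constsB (Constraint.builtins c)

varsMap : MapRule → List Var
varsMap r = varsA (MapRule.head r)
         ++ concatMap varsA (MapRule.body r)
         ++ concatMap varsB (MapRule.builtins r)

constsMap : MapRule → List Const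
constsMap r = constsA (MapRule.head r)
           ++ concatMap constsA (MapRule.body r)
           ++ concatMap constsB (MapRule.builtins r)

SafeStd : StdRule → Set
SafeStd r = ∀ v → v ∈ varsStd r → v ∈ concatMap varsA (posAtoms (StdRule.body r))

SafeIC : Constraint → Set
SafeIC c = ∀ v → v ∈ varsIC c → v ∈ concatMap varsA (posAtoms (Constraint.body c))

SafeMap : MapRule → Set
SafeMap r = ∀ v → v ∈ varsMap r → v ∈ concatMap varsA (MapRule.body r)

PeerOK : List Const → ℕ → PeerId → Peer → Set
PeerOK cs n i P =
    All (λ a → GAtom.peer a ≡ i × All (_∈ cs) (GAtom.args a)) (Peer.D P)
  × All (λ r → Atom.peer (StdRule.head r) ≡ i
             × All (λ l → Atom.peer (litAtom l) ≡ i) (StdRule.body r)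
             × SafeStd r
             × All (_∈ cs) (constsStd r)) (Peer.LP P)
  × All (λ r → Atom.peer (MapRule.head r) ≡ i
             × Σ PeerId (λ j → 1 ≤ j × j ≤ n × j ≢ i
                              × All (λ a → Atom.peer a ≡ j) (MapRule.body r))
             × SafeMap r
             × All (_∈ cs) (constsMap r)) (Peer.MP P)
  × All (λ c → All (λ l → Atom.peer (litAtom l) ≡ i) (Constraint.body c)
             × SafeIC c
             × All (_∈ cs) (constsIC c)) (Peer.IC P)

UniqueMappingHeads : List MapRule → Set
UniqueMappingHeads mp = ∀ r r′ → r ∈ mp → r′ ∈ mp →
  Atom.peer (MapRule.head r) ≡ Atom.peer (MapRule.head r′) →
  Atom.pred (MapRule.head r) ≡ Atom.pred (MapRule.head r′) → r ≡ r′

WellFormed : P2PSystem → Set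
WellFormed PS =
    (∀ (k : Fin (length (P2PSystem.peers PS))) →
        PeerOK (P2PSystem.consts PS) (length (P2PSystem.peers PS))
               (suc (toℕ k)) (lookup (P2PSystem.peers PS) k))
  × UniqueMappingHeads (MPᵘ PS)

NoNegInLP : P2PSystem → Set
NoNegInLP PS = All (λ r → negAtoms (StdRule.body r) ≡ []) (LPᵘ PS)

Subst : Set
Subst = Var → Const

gT : Subst → Term → Const
gT σ (con c) = c
gT σ (var v) = σ v

gA : Subst → Atom → GAtom
gA σ a = gatom (Atom.peer a) (Atom.pred a) (map (gT σ) (Atom.args a))

holdsCmp : Cmp → ℕ → ℕ → Set
holdsCmp lt m n = m < n
holdsCmp gt m n = m > n
holdsCmp le m n = m ≤ n
holdsCmp ge m n = m ≥ n
holdsCmp eq m n = m ≡ n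
holdsCmp ne m n = m ≢ n

holdsB : Subst → BuiltIn → Set
holdsB σ b = holdsCmp (BuiltIn.cmp b) (gT σ (BuiltIn.lhs b)) (gT σ (BuiltIn.rhs b))

-- σ yields a ground instance (over the fixed constants) of a rule with variables vs
Admissible : List Const → List Var → Subst → Set
Admissible cs vs σ = All (λ v → σ v ∈ cs) vs

Interp : Set₁
Interp = GAtom → Set

_⊆ᵢ_ : Interp → Interp → Set
M ⊆ᵢ N = ∀ a → M a → N a

_≐_ : Interp → Interp → Set
M ≐ N = M ⊆ᵢ N × N ⊆ᵢ M

-- N is a model of St(PS^M)   (M determines the reduct, N is tested)

record IsModelOfReduct (PS : P2PSystem) (M N : Interp) : Set where
  field
    facts : ∀ a → a ∈ Dᵘ PS → N a
    std   : ∀ r → r ∈ LPᵘ PS → ∀ σ → Admissible (P2PSystem.consts PS) (varsStd r) σ →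
            -- the ground rule survives the reduct
            All (λ A → ¬ M (gA σ A)) (negAtoms (StdRule.body r)) →
            All (λ A → N (gA σ A)) (posAtoms (StdRule.body r)) →
            All (holdsB σ) (StdRule.builtins r) →
            N (gA σ (StdRule.head r))
    ic    : ∀ c → c ∈ ICᵘ PS → ∀ σ → Admissible (P2PSystem.consts PS) (varsIC c) σ →
            All (λ A → ¬ M (gA σ A)) (negAtoms (Constraint.body c)) →
            All (λ A → N (gA σ A)) (posAtoms (Constraint.body c)) →
            All (holdsB σ) (Constraint.builtins c) →
            ⊥
    maps  : ∀ r → r ∈ MPᵘ PS → ∀ σ → Admissible (P2PSystem.consts PS) (varsMap r) σ →
            -- the ground mapping rule survives the reduct (head in M); St(r)
            M (gA σ (MapRule.head r)) →
            All (λ A → N (gA σ A)) (MapRule.body r) →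
            All (holdsB σ) (MapRule.builtins r) →
            N (gA σ (MapRule.head r))

IsMinimalModelOfReduct : P2PSystem → Interp → Interp → Set₁
IsMinimalModelOfReduct PS M N =
  IsModelOfReduct PS M N × (∀ N′ → IsModelOfReduct PS M N′ → N′ ⊆ᵢ N → N ⊆ᵢ N′)

IsWeakModel : P2PSystem → Interp → Set₁
IsWeakModel PS M =
  IsMinimalModelOfReduct PS M M × (∀ N → IsMinimalModelOfReduct PS M N → N ≐ M)

WM : P2PSystem → Set₁
WM PS = Σ Interp (IsWeakModel PS)

IsMaxMapAtom : P2PSystem → GAtom → Set
IsMaxMapAtom PS a = Σ MapRule λ r → r ∈ MPᵘ PS × MapRule.kind r ≡ maximal
  × Atom.peer (MapRule.head r) ≡ GAtom.peer a × Atom.pred (MapRule.head r) ≡ GAtom.pred a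

IsMinMapAtom : P2PSystem → GAtom → Set
IsMinMapAtom PS a = Σ MapRule λ r → r ∈ MPᵘ PS × MapRule.kind r ≡ minimal
  × Atom.peer (MapRule.head r) ≡ GAtom.peer a × Atom.pred (MapRule.head r) ≡ GAtom.pred a

_[max]_ : Interp → P2PSystem → Interp
(M [max] PS) a = IsMaxMapAtom PS a × M a

_[min]_ : Interp → P2PSystem → Interp
(M [min] PS) a = IsMinMapAtom PS a × M a

Pref : P2PSystem → Interp → Interp → Set
Pref PS M N =
    ((N [max] PS) ⊆ᵢ (M [max] PS) × ¬ ((M [max] PS) ≐ (N [max] PS)))
  ⊎ ((M [max] PS) ≐ (N [max] PS) × (M [min] PS) ⊆ᵢ (N [min] PS))

_≈WM_ : {PS : P2PSystem} → WM PS → WM PS → Set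
M ≈WM N = proj₁ M ≐ proj₁ N

⊒WM : (PS : P2PSystem) → WM PS → WM PS → Set
⊒WM PS M N = Pref PS (proj₁ M) (proj₁ N)

module Submission where

open import Defs
open import Relation.Binary.Structures using (IsPartialOrder; IsEquivalence)
open import Data.Product using (_×_; _,_; proj₁; proj₂)
open import Data.Sum using (_⊎_; inj₁; inj₂)
open import Data.Empty using (⊥-elim)
open import Relation.Nullary using (¬_)
open import Data.List.Membership.Propositional using (_∈_)
open import Data.List.Relation.Unary.All as All using (All)
open import Relation.Binary.PropositionalEquality using (refl; sym; subst)

-- For antisymmetry, M ⊒ N ⊒ M
-- forces M and N to agree on all mapping atoms; then M ∩ N is a model of
-- St(PS^M): without negation in LP the reduct of the standard rules does not
-- depend on M, and the mapping rules surviving the reduct have their heads in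
-- M, hence in N.  Minimality of M gives M ⊆ N, and symmetrically N ⊆ M.

⊆ᵢ-refl : {M : Interp} → M ⊆ᵢ M
⊆ᵢ-refl _ Ma = Ma

⊆ᵢ-trans : {M N O : Interp} → M ⊆ᵢ N → N ⊆ᵢ O → M ⊆ᵢ O
⊆ᵢ-trans M⊆N N⊆O a Ma = N⊆O a (M⊆N a Ma)

≐-isEquivalence : IsEquivalence _≐_
≐-isEquivalence = record
  { refl  = ⊆ᵢ-refl , ⊆ᵢ-refl
  ; sym   = λ (M⊆N , N⊆M) → N⊆M , M⊆N
  ; trans = λ (M⊆N , N⊆M) (N⊆O , O⊆N) → ⊆ᵢ-trans M⊆N N⊆O , ⊆ᵢ-trans O⊆N N⊆M
  }

module _ (PS : P2PSystem) where

  [max]-mono : {M N : Interp} → M ⊆ᵢ N → (M [max] PS) ⊆ᵢ (N [max] PS)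
  [max]-mono M⊆N a (isMax , Ma) = isMax , M⊆N a Ma

  [min]-mono : {M N : Interp} → M ⊆ᵢ N → (M [min] PS) ⊆ᵢ (N [min] PS)
  [min]-mono M⊆N a (isMin , Ma) = isMin , M⊆N a Ma

  Pref-reflexive : {M N : Interp} → M ≐ N → Pref PS M N
  Pref-reflexive (M⊆N , N⊆M) = inj₂ (([max]-mono M⊆N , [max]-mono N⊆M) , [min]-mono M⊆N)

  Pref-trans : {M N O : Interp} → Pref PS M N → Pref PS N O → Pref PS M O
  Pref-trans (inj₁ (N⊆M , M≉N)) (inj₁ (O⊆N , _)) =
    inj₁ (⊆ᵢ-trans O⊆N N⊆M , λ (M⊆O , _) → M≉N (⊆ᵢ-trans M⊆O O⊆N , N⊆M))
  Pref-trans (inj₁ (N⊆M , M≉N)) (inj₂ ((N⊆O , O⊆N) , _)) =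
    inj₁ (⊆ᵢ-trans O⊆N N⊆M , λ (M⊆O , _) → M≉N (⊆ᵢ-trans M⊆O O⊆N , N⊆M))
  Pref-trans (inj₂ ((M⊆N , N⊆M) , _)) (inj₁ (O⊆N , N≉O)) =
    inj₁ (⊆ᵢ-trans O⊆N N⊆M , λ (M⊆O , O⊆M) → N≉O (⊆ᵢ-trans N⊆M M⊆O , ⊆ᵢ-trans O⊆M M⊆N))
  Pref-trans (inj₂ (M≐N , minM⊆minN)) (inj₂ (N≐O , minN⊆minO)) =
    inj₂ (IsEquivalence.trans ≐-isEquivalence M≐N N≐O , ⊆ᵢ-trans minM⊆minN minN⊆minO)

  Pref-antisym : {M N : Interp} → Pref PS M N → Pref PS N M →
                 (M [max] PS) ≐ (N [max] PS) × (M [min] PS) ≐ (N [min] PS)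
  Pref-antisym (inj₁ (N⊆M , M≉N)) (inj₁ (M⊆N , _))       = ⊥-elim (M≉N (M⊆N , N⊆M))
  Pref-antisym (inj₁ (_ , M≉N))   (inj₂ ((N⊆M , M⊆N) , _)) = ⊥-elim (M≉N (M⊆N , N⊆M))
  Pref-antisym (inj₂ ((M⊆N , N⊆M) , _)) (inj₁ (_ , N≉M)) = ⊥-elim (N≉M (N⊆M , M⊆N))
  Pref-antisym (inj₂ (M≐N , minM⊆minN)) (inj₂ (_ , minN⊆minM)) =
    M≐N , (minM⊆minN , minN⊆minM)

  mappingHead-isMapAtom : (r : MapRule) → r ∈ MPᵘ PS → (σ : Subst) →
    IsMaxMapAtom PS (gA σ (MapRule.head r)) ⊎ IsMinMapAtom PS (gA σ (MapRule.head r))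
  mappingHead-isMapAtom r@(mapRule maximal _ _ _) r∈MP σ = inj₁ (r , r∈MP , refl , refl , refl)
  mappingHead-isMapAtom r@(mapRule minimal _ _ _) r∈MP σ = inj₂ (r , r∈MP , refl , refl , refl)

  module _ (noNeg : NoNegInLP PS) where

    reductModel-∩ : {M N : Interp} → IsModelOfReduct PS M M → IsModelOfReduct PS N N →
      (M [max] PS) ⊆ᵢ (N [max] PS) → (M [min] PS) ⊆ᵢ (N [min] PS) →
      IsModelOfReduct PS M (λ a → M a × N a)
    reductModel-∩ {M} {N} modelM modelN maxM⊆N minM⊆N = record
      { facts = λ a a∈D → facts modelM a a∈D , facts modelN a a∈D
      ; std   = λ r r∈LP σ adm negOK body bi →
          std modelM r r∈LP σ adm negOK (All.map proj₁ body) bi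
        , std modelN r r∈LP σ adm (noNegBody r∈LP) (All.map proj₂ body) bi
      ; ic    = λ c c∈IC σ adm negOK body bi →
          ic modelM c c∈IC σ adm negOK (All.map proj₁ body) bi
      ; maps  = λ r r∈MP σ adm headM body bi → headM , headInN r r∈MP σ headM
      }
      where
      open IsModelOfReduct

      noNegBody : ∀ {r σ} → r ∈ LPᵘ PS →
                  All (λ A → ¬ N (gA σ A)) (negAtoms (StdRule.body r))
      noNegBody r∈LP = subst (All _) (sym (All.lookup noNeg r∈LP)) All.[]

      headInN : ∀ r → r ∈ MPᵘ PS → ∀ σ → M (gA σ (MapRule.head r)) → N (gA σ (MapRule.head r))
      headInN r r∈MP σ headM with mappingHead-isMapAtom r r∈MP σ
      ... | inj₁ isMax = proj₂ (maxM⊆N _ (isMax , headM))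
      ... | inj₂ isMin = proj₂ (minM⊆N _ (isMin , headM))

    minimalSelfModel-⊆ : {M N : Interp} →
      IsMinimalModelOfReduct PS M M → IsModelOfReduct PS N N →
      (M [max] PS) ⊆ᵢ (N [max] PS) → (M [min] PS) ⊆ᵢ (N [min] PS) → M ⊆ᵢ N
    minimalSelfModel-⊆ (modelM , minimalM) modelN maxM⊆N minM⊆N a Ma =
      proj₂ (minimalM _ (reductModel-∩ modelM modelN maxM⊆N minM⊆N) (λ _ → proj₁) a Ma)

    ⊒WM-antisym : {M N : WM PS} → ⊒WM PS M N → ⊒WM PS N M → _≈WM_ {PS} M N
    ⊒WM-antisym {M , (minimalM , _)} {N , (minimalN , _)} M⊒N N⊒M
      with ((maxM⊆N , maxN⊆M) , (minM⊆N , minN⊆M)) ← Pref-antisym M⊒N N⊒M =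
        minimalSelfModel-⊆ minimalM (proj₁ minimalN) maxM⊆N minM⊆N ,
        minimalSelfModel-⊆ minimalN (proj₁ minimalM) maxN⊆M minN⊆M

mainTheorem7 : (PS : P2PSystem) → WellFormed PS → NoNegInLP PS →
    IsPartialOrder (_≈WM_ {PS}) (⊒WM PS)
mainTheorem7 PS _ noNeg = record
  { isPreorder = record
    { isEquivalence = record
      { refl  = IsEquivalence.refl ≐-isEquivalence
      ; sym   = IsEquivalence.sym ≐-isEquivalence
      ; trans = IsEquivalence.trans ≐-isEquivalence
      }
    ; reflexive = Pref-reflexive PS
    ; trans     = Pref-trans PS
    }
  ; antisym = λ {M} {N} → ⊒WM-antisym PS noNeg {M} {N}
  }
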